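{- Let $\epsilon=(\epsilon_1,\dots,\epsilon_s)$ be a circular sequence with $\epsilon_j\in\{1,-1\}$ for all $j$ and $\sum_{j=1}^s\epsilon_j=0$. Then, as a circular sequence, $\epsilon$ decomposes as a concatenation $\epsilon=(\widehat{\epsilon}_t,\widehat{\epsilon}_{t-1},\dots,\widehat{\epsilon}_1)$ of consecutive blocks such that each $\widehat{\epsilon}_i$ is a free linear segment of $\epsilon$ of some level $\lambda_i$ with $1\le\lambda_i\le\lambda_\epsilon$.
   Context: Indices are mod $s$. $\lambda_\epsilon=\max\{|\sum_{i=a}^b\epsilon_i|:1\le a\le s,\ a\le b\le a+s-1\}$. For $\lambda\ge1$, a free linear segment of level $\lambda$ is a run of consecutive entries $\epsilon_a,\dots,\epsilon_b$ ($a\le b$, indices mod $s$) with $\epsilon_a=-1$, $\epsilon_b=1$, $\sum_{j=a}^b\epsilon_j=0$, $-\lambda\le\sum_{j=a}^i\epsilon_j<0$ for all $a\le i<b$, and $\sum_{j=a}^{i_1}\epsilon_j=-\lambda$ for some $a\le i_1<b$. -}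

module Defs where

open import Data.Nat as ℕ using (ℕ; zero; suc; NonZero; _%_)
open import Data.Nat.Properties using ()
open import Data.Fin using (Fin; fromℕ<)
open import Data.Nat.DivMod using (m%n<n)
open import Data.Integer as ℤ using (ℤ; +_; -_; ∣_∣)
open import Data.List using (List; []; _∷_; map; upTo; foldr)
open import Data.Product using (Σ; _×_; ∃-syntax)
open import Data.Sum using (_⊎_)
open import Relation.Binary.PropositionalEquality using (_≡_)

-- A circular sequence of length s is ε : Fin s → ℤ (0-based: position j of
-- the paper corresponds to Fin index j-1).  Entries lie in {1,-1}.
IsSignSeq : (s : ℕ) → (Fin s → ℤ) → Set
IsSignSeq s ε = ∀ j → ε j ≡ ℤ.1ℤ ⊎ ε j ≡ ℤ.-1ℤ

at : (s : ℕ) .{{_ : NonZero s}} → (Fin s → ℤ) → ℕ → ℤ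
at s ε i = ε (fromℕ< (m%n<n i s))

seg : (s : ℕ) .{{_ : NonZero s}} → (Fin s → ℤ) → ℕ → ℕ → ℤ
seg s ε a zero    = at s ε a
seg s ε a (suc k) = seg s ε a k ℤ.+ at s ε (a ℕ.+ suc k)

total : (s : ℕ) → (Fin s → ℤ) → ℤ
total s ε = foldr ℤ._+_ ℤ.0ℤ (Data.List.map ε (Data.List.allFin s))
  where import Data.List

maxList : List ℕ → ℕ
maxList []       = 0
maxList (x ∷ xs) = x ℕ.⊔ maxList xs

lambdaEps : (s : ℕ) .{{_ : NonZero s}} → (Fin s → ℤ) → ℕ
lambdaEps s ε =
  maxList (Data.List.concatMap (λ a → map (λ k → ∣ seg s ε a k ∣) (upTo s)) (upTo s))
  where import Data.List

FreeLinearSegment : (s : ℕ) .{{_ : NonZero s}} → (Fin s → ℤ) → (a k lv : ℕ) → Set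
FreeLinearSegment s ε a k lv =
  at s ε a ≡ ℤ.-1ℤ
  × at s ε (a ℕ.+ k) ≡ ℤ.1ℤ
  × seg s ε a k ≡ ℤ.0ℤ
  × (∀ i → i ℕ.< k → (- (+ lv)) ℤ.≤ seg s ε a i × seg s ε a i ℤ.< ℤ.0ℤ)
  × (∃[ i₁ ] (i₁ ℕ.< k × seg s ε a i₁ ≡ - (+ lv)))

-- Consecutive blocks starting at position `start`, the i-th block having
-- length suc kᵢ, each a free linear segment of some level λᵢ, 1 ≤ λᵢ ≤ λ_ε.
FreeBlocks : (s : ℕ) .{{_ : NonZero s}} → (Fin s → ℤ) → ℕ → List ℕ → Set
FreeBlocks s ε start []       = Data.Unit.⊤
  where import Data.Unit
FreeBlocks s ε start (k ∷ ks) =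
  (∃[ lv ] (1 ℕ.≤ lv × lv ℕ.≤ lambdaEps s ε × FreeLinearSegment s ε start k lv))
  × FreeBlocks s ε (start ℕ.+ suc k) ks

blocksLength : List ℕ → ℕ
blocksLength ks = foldr ℕ._+_ 0 (map suc ks)

module Submission where

-- Let P(n) = ε₀ + … + ε_{n-1} be the prefix sums of the periodic extension
-- of ε.  Because the total sum is 0, P is s-periodic, so it attains its
-- maximum at some position a < s.  Starting from any position b where P
-- takes this maximal value, every partial sum ε_b + … + ε_{b+i} is ≤ 0.
-- Cut the sequence at the first index k > b at which P returns to its
-- maximum: the partial sums from b are then strictly negative before k and
-- zero at k, i.e. ε_b … ε_{k-1} is a negative excursion, and every negative
-- excursion is a free linear segment whose level is minus its smallest
-- partial sum, which is between 1 and λ_ε.  Repeating from k, and using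
-- P(a + s) = P(a), cuts ε_a … ε_{a+s-1} into such blocks.

open import Defs
open import Data.Nat using (ℕ; NonZero; _<_)
open import Data.Fin using (Fin)
open import Data.Integer using (ℤ; 0ℤ)
open import Data.Product using (_×_; ∃-syntax)
open import Relation.Binary.PropositionalEquality using (_≡_)

open import Data.Nat as ℕ using (zero; suc; _%_; _/_; z≤n; s≤s; _∸_)
import Data.Nat.Properties as ℕP
open import Data.Nat.Induction using (<-rec)
open import Data.Nat.DivMod
  using (m%n<n; m≡m%n+[m/n]*n; m%n%n≡m%n; [m+n]%n≡m%n; m<n⇒m%n≡m; %-distribˡ-+)
open import Data.Fin as Fin using (toℕ; fromℕ<)
open import Data.Fin.Properties using (toℕ-injective; toℕ-fromℕ<; toℕ<n)
open import Data.Integer as ℤ using (+_; -[1+_]; -_; ∣_∣; _-_; +<+)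
import Data.Integer.Properties as ℤP
open import Data.List using ([]; _∷_; upTo; tabulate; foldr; map; allFin)
open import Data.List.Properties using (map-tabulate)
open import Data.List.Membership.Propositional using (_∈_; lose)
open import Data.List.Membership.Propositional.Properties
  using (∈-map⁺; ∈-concatMap⁺; ∈-upTo⁺)
open import Data.List.Relation.Unary.Any using (here; there)
open import Data.Product using (_,_; proj₁; proj₂)
open import Data.Sum using (_⊎_; inj₁; inj₂; [_,_])
open import Data.Empty using (⊥-elim)
open import Data.Unit using (tt)
open import Relation.Nullary using (¬_; yes; no)
open import Relation.Unary using (Decidable)
open import Relation.Binary.PropositionalEquality
  using (_≢_; refl; sym; trans; cong; cong₂; subst; module ≡-Reasoning)
open import Algebra.Properties.CommutativeSemigroup ℤP.+-commutativeSemigroup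
  using (xy∙z≈xz∙y)
open import Algebra.Bundles using (AbelianGroup)
open import Algebra.Properties.Group (AbelianGroup.group ℤP.+-0-abelianGroup)
  using (inverseʳ-unique)

IsSign : ℤ → Set
IsSign x = x ≡ ℤ.1ℤ ⊎ x ≡ ℤ.-1ℤ

-- A single entry never sums to 0, so no block has length 1.
sign≢0 : ∀ {x} → IsSign x → x ≢ 0ℤ
sign≢0 (inj₁ refl) ()
sign≢0 (inj₂ refl) ()

negative-sign : ∀ {x} → IsSign x → x ℤ.< 0ℤ → x ≡ ℤ.-1ℤ
negative-sign (inj₁ refl) (+<+ ())
negative-sign (inj₂ x≡-1) _ = x≡-1

positive-sign : ∀ {x} → IsSign x → 0ℤ ℤ.< x → x ≡ ℤ.1ℤ
positive-sign (inj₁ x≡1) _ = x≡1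
positive-sign (inj₂ refl) ()

-- A negative integer is -(1+n); this 1+n becomes the level of a segment.
negative-form : ∀ x → x ℤ.< 0ℤ → ∃[ n ] (x ≡ - (+ suc n))
negative-form (+ _)    (+<+ ())
negative-form -[1+ n ] _ = n , refl

least-witness : ∀ {Q : ℕ → Set} → Decidable Q → ∀ {r} → Q r →
  ∃[ j ] (j ℕ.≤ r × Q j × (∀ i → i < j → ¬ Q i))
least-witness Q? {zero} q = 0 , z≤n , q , λ _ ()
least-witness {Q} Q? {suc r} q with Q? 0
... | yes q0 = 0 , z≤n , q0 , λ _ ()
... | no ¬q0 with least-witness (λ i → Q? (suc i)) {r} q
...   | j , j≤r , qj , below = suc j , s≤s j≤r , qj , below′
  where
  below′ : ∀ i → i < suc j → ¬ Q i
  below′ zero    _         = ¬q0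
  below′ (suc i) (s≤s i<j) = below i i<j

minimum-on : (g : ℕ → ℤ) → ∀ k →
  ∃[ j ] (j < suc k × (∀ i → i < suc k → g j ℤ.≤ g i))
minimum-on g zero = 0 , s≤s z≤n , λ { zero _ → ℤP.≤-refl ; (suc _) (s≤s ()) }
minimum-on g (suc k) with minimum-on g k
... | j , j≤k , min-j with ℤP.≤-total (g j) (g (suc k))
...   | inj₁ gj≤gk = j , ℕP.m<n⇒m<1+n j≤k , λ i i≤k+1 →
        [ min-j i , (λ i≡k+1 → subst (λ t → g j ℤ.≤ g t) (sym i≡k+1) gj≤gk) ]
        (ℕP.m<1+n⇒m<n∨m≡n i≤k+1)
...   | inj₂ gk≤gj = suc k , ℕP.n<1+n (suc k) , λ i i≤k+1 →
        [ (λ i≤k → ℤP.≤-trans gk≤gj (min-j i i≤k))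
        , (λ i≡k+1 → subst (λ t → g (suc k) ℤ.≤ g t) (sym i≡k+1) ℤP.≤-refl) ]
        (ℕP.m<1+n⇒m<n∨m≡n i≤k+1)

maximum-on : (g : ℕ → ℤ) → ∀ k →
  ∃[ j ] (j < suc k × (∀ i → i < suc k → g i ℤ.≤ g j))
maximum-on g k with minimum-on (λ i → - g i) k
... | j , j≤k , min-j = j , j≤k , λ i i≤k → ℤP.neg-cancel-≤ (min-j i i≤k)

prefix-sum : (ℕ → ℤ) → ℕ → ℤ
prefix-sum h zero    = 0ℤ
prefix-sum h (suc n) = prefix-sum h n ℤ.+ h n

prefix-sum-suc : ∀ h n →
  prefix-sum h (suc n) ≡ h 0 ℤ.+ prefix-sum (λ i → h (suc i)) n
prefix-sum-suc h zero = trans (ℤP.+-identityˡ (h 0)) (sym (ℤP.+-identityʳ (h 0)))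
prefix-sum-suc h (suc n) =
  trans (cong (ℤ._+ h (suc n)) (prefix-sum-suc h n)) (ℤP.+-assoc (h 0) _ (h (suc n)))

sum-tabulate : ∀ n (g : Fin n → ℤ) (h : ℕ → ℤ) → (∀ i → g i ≡ h (toℕ i)) →
  foldr ℤ._+_ 0ℤ (tabulate g) ≡ prefix-sum h n
sum-tabulate zero    g h g≗h = refl
sum-tabulate (suc n) g h g≗h = trans
  (cong₂ ℤ._+_ (g≗h Fin.zero)
     (sum-tabulate n (λ i → g (Fin.suc i)) (λ i → h (suc i)) (λ i → g≗h (Fin.suc i))))
  (sym (prefix-sum-suc h n))

maxList-upper : ∀ {x xs} → x ∈ xs → x ℕ.≤ maxList xs
maxList-upper (here refl) = ℕP.m≤m⊔n _ _
maxList-upper {xs = y ∷ ys} (there x∈ys) =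
  ℕP.≤-trans (maxList-upper x∈ys) (ℕP.m≤n⊔m y (maxList ys))

module Sequence (s : ℕ) .{{_ : NonZero s}} (ε : Fin s → ℤ) where

  at-mod : ∀ m n → m % s ≡ n % s → at s ε m ≡ at s ε n
  at-mod m n m≡n = cong ε (toℕ-injective (begin
    toℕ (fromℕ< (m%n<n m s)) ≡⟨ toℕ-fromℕ< (m%n<n m s) ⟩
    m % s                    ≡⟨ m≡n ⟩
    n % s                    ≡⟨ toℕ-fromℕ< (m%n<n n s) ⟨
    toℕ (fromℕ< (m%n<n n s)) ∎))
    where open ≡-Reasoning

  at-toℕ : ∀ (i : Fin s) → ε i ≡ at s ε (toℕ i)
  at-toℕ i = cong ε (toℕ-injective
    (sym (trans (toℕ-fromℕ< (m%n<n (toℕ i) s)) (m<n⇒m%n≡m (toℕ<n i)))))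

  at-sign : IsSignSeq s ε → ∀ n → IsSign (at s ε n)
  at-sign sgn n = sgn _

  seg-mod : ∀ b k → seg s ε b k ≡ seg s ε (b % s) k
  seg-mod b zero    = at-mod b (b % s) (sym (m%n%n≡m%n b s))
  seg-mod b (suc k) = cong₂ ℤ._+_ (seg-mod b k) (at-mod _ _ (shift (suc k)))
    where
    shift : ∀ x → (b ℕ.+ x) % s ≡ (b % s ℕ.+ x) % s
    shift x = trans (%-distribˡ-+ b x s) (sym (trans (%-distribˡ-+ (b % s) x s)
                (cong (λ t → (t ℕ.+ x % s) % s) (m%n%n≡m%n b s))))

  ∣seg∣≤λ : ∀ b i → i < s → ∣ seg s ε b i ∣ ℕ.≤ lambdaEps s ε
  ∣seg∣≤λ b i i<s = subst (ℕ._≤ lambdaEps s ε) (cong ∣_∣ (sym (seg-mod b i)))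
    (maxList-upper (∈-concatMap⁺ (λ c → map (λ k → ∣ seg s ε c k ∣) (upTo s))
      (lose (∈-upTo⁺ (m%n<n b s))
            (∈-map⁺ (λ k → ∣ seg s ε (b % s) k ∣) (∈-upTo⁺ i<s)))))

  FreeBlock : ℕ → ℕ → Set
  FreeBlock b k =
    ∃[ lv ] (1 ℕ.≤ lv × lv ℕ.≤ lambdaEps s ε × FreeLinearSegment s ε b k lv)

  -- A negative excursion (partial sums from b negative up to index k and
  -- vanishing at k+1) is a free linear segment; its level is minus the
  -- smallest partial sum, which is at least 1 and at most λ_ε.
  excursion⇒free : IsSignSeq s ε → ∀ b k → k < s →
    seg s ε b (suc k) ≡ 0ℤ → (∀ i → i < suc k → seg s ε b i ℤ.< 0ℤ) →
    FreeBlock b (suc k)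
  excursion⇒free sgn b k k<s closes negative with minimum-on (seg s ε b) k
  ... | j , j≤k , min-j with negative-form (seg s ε b j) (negative j j≤k)
  ...   | n , seg-j = suc n , s≤s z≤n , level≤λ , first , last , closes , bounds ,
                      (j , j≤k , seg-j)
    where
    level≤λ : suc n ℕ.≤ lambdaEps s ε
    level≤λ = subst (ℕ._≤ lambdaEps s ε) (cong ∣_∣ seg-j)
                (∣seg∣≤λ b j (ℕP.<-≤-trans j≤k k<s))

    first : at s ε b ≡ ℤ.-1ℤ
    first = negative-sign (at-sign sgn b) (negative 0 (s≤s z≤n))

    -- the last entry cancels the negative sum before it, so it is +1
    last : at s ε (b ℕ.+ suc k) ≡ ℤ.1ℤ
    last = positive-sign (at-sign sgn _)
      (subst (0ℤ ℤ.<_) (sym (inverseʳ-unique (seg s ε b k) _ closes))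
        (ℤP.neg-mono-< (negative k (ℕP.n<1+n k))))

    bounds : ∀ i → i < suc k → - (+ suc n) ℤ.≤ seg s ε b i × seg s ε b i ℤ.< 0ℤ
    bounds i i≤k = subst (ℤ._≤ seg s ε b i) seg-j (min-j i i≤k) , negative i i≤k

module Balanced (s : ℕ) .{{_ : NonZero s}} (ε : Fin s → ℤ)
                (sgn : IsSignSeq s ε) (balanced : total s ε ≡ 0ℤ) where

  open Sequence s ε
  open ≡-Reasoning

  P : ℕ → ℤ
  P = prefix-sum (at s ε)

  seg≡ΔP : ∀ b k → seg s ε b k ≡ P (b ℕ.+ suc k) - P b
  seg≡ΔP b zero = begin
    at s ε b                   ≡⟨ ℤP.+-identityˡ (at s ε b) ⟨
    0ℤ ℤ.+ at s ε b            ≡⟨ cong (ℤ._+ at s ε b) (ℤP.+-inverseʳ (P b)) ⟨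
    (P b - P b) ℤ.+ at s ε b   ≡⟨ xy∙z≈xz∙y (P b) (- P b) (at s ε b) ⟩
    P (suc b) - P b            ≡⟨ cong (λ t → P t - P b) (ℕP.+-comm b 1) ⟨
    P (b ℕ.+ 1) - P b          ∎
  seg≡ΔP b (suc k) = begin
    seg s ε b k ℤ.+ at s ε n      ≡⟨ cong (ℤ._+ at s ε n) (seg≡ΔP b k) ⟩
    (P n - P b) ℤ.+ at s ε n      ≡⟨ xy∙z≈xz∙y (P n) (- P b) (at s ε n) ⟩
    P (suc n) - P b               ≡⟨ cong (λ t → P t - P b) (ℕP.+-suc b (suc k)) ⟨
    P (b ℕ.+ suc (suc k)) - P b   ∎
    where
    n : ℕ
    n = b ℕ.+ suc k

  P-total : P s ≡ 0ℤ
  P-total = begin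
    P s                                 ≡⟨ sum-tabulate s ε (at s ε) at-toℕ ⟨
    foldr ℤ._+_ 0ℤ (tabulate ε)         ≡⟨ cong (foldr ℤ._+_ 0ℤ) (map-tabulate (λ i → i) ε) ⟨
    foldr ℤ._+_ 0ℤ (map ε (allFin s))   ≡⟨ balanced ⟩
    0ℤ                                  ∎

  P-periodic : ∀ n → P (n ℕ.+ s) ≡ P n
  P-periodic zero    = P-total
  P-periodic (suc n) = cong₂ ℤ._+_ (P-periodic n) (at-mod (n ℕ.+ s) n ([m+n]%n≡m%n n s))

  P-mod : ∀ n → P n ≡ P (n % s)
  P-mod n = trans (cong P (m≡m%n+[m/n]*n n s)) (periods (n / s) (n % s))
    where
    periods : ∀ q m → P (m ℕ.+ q ℕ.* s) ≡ P m
    periods zero    m = cong P (ℕP.+-identityʳ m)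
    periods (suc q) m = begin
      P (m ℕ.+ (s ℕ.+ q ℕ.* s)) ≡⟨ cong (λ t → P (m ℕ.+ t)) (ℕP.+-comm s (q ℕ.* s)) ⟩
      P (m ℕ.+ (q ℕ.* s ℕ.+ s)) ≡⟨ cong P (ℕP.+-assoc m (q ℕ.* s) s) ⟨
      P (m ℕ.+ q ℕ.* s ℕ.+ s)   ≡⟨ P-periodic (m ℕ.+ q ℕ.* s) ⟩
      P (m ℕ.+ q ℕ.* s)         ≡⟨ periods q m ⟩
      P m                       ∎

  top-exists : ∃[ a ] (a < s × (∀ i → i < s → P i ℤ.≤ P a))
  top-exists = subst (λ m → ∃[ a ] (a < m × (∀ i → i < m → P i ℤ.≤ P a)))
                     (ℕP.suc-pred s) (maximum-on P (ℕ.pred s))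

  top : ℕ
  top = proj₁ top-exists

  top<s : top < s
  top<s = proj₁ (proj₂ top-exists)

  P≤top : ∀ n → P n ℤ.≤ P top
  P≤top n = subst (ℤ._≤ P top) (sym (P-mod n))
                  (proj₂ (proj₂ top-exists) (n % s) (m%n<n n s))

  seg≤0 : ∀ b k → P b ≡ P top → seg s ε b k ℤ.≤ 0ℤ
  seg≤0 b k Pb = subst (ℤ._≤ 0ℤ) (sym (seg≡ΔP b k))
    (ℤP.i≤j⇒i-j≤0 (subst (P (b ℕ.+ suc k) ℤ.≤_) (sym Pb) (P≤top (b ℕ.+ suc k))))

  first-block : ∀ b r → suc r ℕ.≤ s → P b ≡ P top → P (b ℕ.+ suc r) ≡ P top →
    ∃[ k ] (k ℕ.≤ r × FreeBlock b k × P (b ℕ.+ suc k) ≡ P top)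
  first-block b r r<s Pb Pend
    with least-witness (λ i → seg s ε b i ℤP.≟ 0ℤ) returns
    where
    returns : seg s ε b r ≡ 0ℤ
    returns = trans (seg≡ΔP b r) (trans (cong₂ _-_ Pend Pb) (ℤP.+-inverseʳ (P top)))
  ... | zero , _ , starts-at-0 , _ = ⊥-elim (sign≢0 (at-sign sgn b) starts-at-0)
  ... | suc k , k<r , closes , open-before =
    suc k , k<r , excursion⇒free sgn b k k<s closes negative , Pnext
    where
    k<s : k < s
    k<s = ℕP.≤-trans (ℕP.m≤n⇒m≤1+n k<r) r<s

    negative : ∀ i → i < suc k → seg s ε b i ℤ.< 0ℤ
    negative i i≤k = ℤP.≤∧≢⇒< (seg≤0 b i Pb) (open-before i i≤k)

    Pnext : P (b ℕ.+ suc (suc k)) ≡ P top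
    Pnext = trans (ℤP.i-j≡0⇒i≡j _ _ (trans (sym (seg≡ΔP b (suc k))) closes)) Pb

  Decomposable : ℕ → Set
  Decomposable r = ∀ b → r ℕ.≤ s → P b ≡ P top → P (b ℕ.+ r) ≡ P top →
    ∃[ ks ] (blocksLength ks ≡ r × FreeBlocks s ε b ks)

  decompose : ∀ r → Decomposable r
  decompose = <-rec Decomposable step
    where
    step : ∀ r → (∀ {m} → m < r → Decomposable m) → Decomposable r
    step zero    _   b _   _  _    = [] , refl , tt
    step (suc r) rec b r<s Pb Pend with first-block b r r<s Pb Pend
    ... | k , k≤r , block , Pnext
      with rec (s≤s (ℕP.m∸n≤m r k)) (b ℕ.+ suc k)
               (ℕP.≤-trans (ℕP.m∸n≤m r k) (ℕP.<⇒≤ r<s))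
               Pnext (trans (cong P rest≡) Pend)
      where
      rest≡ : b ℕ.+ suc k ℕ.+ (r ∸ k) ≡ b ℕ.+ suc r
      rest≡ = trans (ℕP.+-assoc b (suc k) (r ∸ k))
                    (cong (λ t → b ℕ.+ suc t) (ℕP.m+[n∸m]≡n k≤r))
    ... | ks , len , blocks =
      k ∷ ks , cong suc (trans (cong (k ℕ.+_) len) (ℕP.m+[n∸m]≡n k≤r)) , block , blocks

lemma4p12 : (s : ℕ) .{{_ : NonZero s}} (ε : Fin s → ℤ) →
    IsSignSeq s ε → total s ε ≡ 0ℤ →
    ∃[ a ] ∃[ ks ] (a < s × blocksLength ks ≡ s × FreeBlocks s ε a ks)
lemma4p12 s ε sgn balanced = top , proj₁ one-period , top<s , proj₂ one-period
  where
  open Balanced s ε sgn balanced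

  one-period : ∃[ ks ] (blocksLength ks ≡ s × FreeBlocks s ε top ks)
  one-period = decompose s top ℕP.≤-refl refl (P-periodic top)
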